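{- Let $k\ge 1$ and let $a,b,c,d$ be nonnegative integers such that every integer $q$ which is the order of some element of the symmetric group $S_k$ satisfies at least one of the following six conditions: (i) $q\mid a$ and $q\mid c$; (ii) $q\mid a+c$ and $q\mid b$; (iii) $q\mid a$ and $b\equiv d\pmod q$; (i') $q\mid d$ and $q\mid b$; (ii') $q\mid d+b$ and $q\mid c$; (iii') $q\mid d$ and $c\equiv a\pmod q$. Then for all $x,y\in S_k$, $$(xy)^a(yx)^b(xy)^c(yx)^d=(yx)^d(xy)^c(yx)^b(xy)^a.$$
   Context: $S_k$ is the symmetric group on $\{1,\ldots,k\}$; $g^0$ denotes the identity element. -}

module Defs where

open import Data.Nat using (ℕ; zero; suc; _+_; _*_; _≤_; _<_)
open import Data.Nat.Divisibility using (_∣_)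
open import Data.Integer as ℤ using (ℤ; +_)
import Data.Integer.Divisibility as ℤD
open import Data.Fin.Permutation using (Permutation′; _∘ₚ_; id) renaming (_≈_ to _≈ₚ_) public
open import Data.Product using (_×_; ∃)
open import Data.Sum using (_⊎_)
open import Relation.Nullary using (¬_)

-- The symmetric group S_k : permutations of Fin k, with equality
-- being pointwise equality of the underlying functions (_≈ₚ_).
S : ℕ → Set
S k = Permutation′ k

-- Group multiplication in S_k with the usual convention
-- (x · y)(i) = x (y i).
_·_ : ∀ {k} → S k → S k → S k
x · y = y ∘ₚ x

infixl 7 _·_

_^_ : ∀ {k} → S k → ℕ → S k
g ^ zero  = id
g ^ suc n = g · (g ^ n)

infixr 8 _^_

IsOrderOf : ∀ {k} → S k → ℕ → Set
IsOrderOf g q = (1 ≤ q) × (g ^ q ≈ₚ id) × (∀ m → 1 ≤ m → m < q → ¬ (g ^ m ≈ₚ id))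

_≡_[mod_] : ℕ → ℕ → ℕ → Set
b ≡ d [mod q ] = (+ q) ℤD.∣ ((+ b) ℤ.- (+ d))

SixConditions : ℕ → ℕ → ℕ → ℕ → ℕ → Set
SixConditions q a b c d =
  ((q ∣ a) × (q ∣ c))
  ⊎ ((q ∣ a + c) × (q ∣ b))
  ⊎ ((q ∣ a) × (b ≡ d [mod q ]))
  ⊎ ((q ∣ d) × (q ∣ b))
  ⊎ ((q ∣ d + b) × (q ∣ c))
  ⊎ ((q ∣ d) × (c ≡ a [mod q ]))

-- Put u = x y and v = y x, and let q be the order of u. Since x v = u x,
-- v is conjugate to u, so v ^ q = 1 as well and the exponents of u and v
-- matter only modulo q. Under (i) both sides reduce to the commuting
-- powers v ^ b and v ^ d, under (ii) to v ^ d (as u ^ a u ^ c = 1), and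
-- under (iii) to v ^ d u ^ c v ^ d. The primed conditions are the
-- unprimed ones for the reversed word, with u and v exchanged.
module Submission where

open import Defs
open import Data.Nat using (ℕ; _≤_)
open import Data.Product using (∃)

open import Algebra.Bundles using (Group)
open import Data.Fin using (toℕ)
open import Data.Fin.Permutation as Perm using (_⟨$⟩ʳ_; _⟨$⟩ˡ_; flip)
open import Data.Fin.Properties using (all?; pigeonhole; toℕ<n; _≟_)
open import Data.Integer using (+_; _-_; ∣_∣)
open import Data.Integer.Properties using (m-n≡m⊖n; ∣m⊖n∣≡∣n⊖m∣; ∣⊖∣-≤; ∣i-j∣≡∣j-i∣)
open import Data.Nat using (zero; suc; _+_; _*_; _∸_; _<_; _!; _≤?_)
open import Data.Nat.Divisibility using (_∣_; divides; ∣-trans; m∣m*n; m≤n⇒m!∣n!)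
open import Data.Nat.Induction using (<-rec)
open import Data.Nat.Properties
  using (+-comm; ≤-total; m∸n+n≡m; m+[n∸m]≡n; m∸n≤m; m<n⇒0<n∸m; <⇒≤; ≤-pred; ≤-trans; n<1+n; 1≤n!; anyUpTo?)
open import Data.Product using (_,_)
open import Data.Sum using (inj₁; inj₂)
open import Function.Bundles using (Injection)
open import Function.Properties.Inverse using (↔⇒↣)
open import Level using (0ℓ)
open import Relation.Binary.PropositionalEquality as ≡ using (_≡_; cong)
open import Relation.Nullary using (¬_; yes; no)
open import Relation.Nullary.Decidable using (_×-dec_)
open import Relation.Unary using (Pred; Decidable)

∣n! : ∀ {r n} → 1 ≤ r → r ≤ n → r ∣ n !
∣n! {suc r} _ r≤n = ∣-trans (m∣m*n (r !)) (m≤n⇒m!∣n! r≤n)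

≡-mod-sym : ∀ {q m n} → m ≡ n [mod q ] → n ≡ m [mod q ]
≡-mod-sym {q} {m} {n} = ≡.subst (q ∣_) (∣i-j∣≡∣j-i∣ (+ m) (+ n))

≡-mod⇒∣∸ : ∀ {q m n} → n ≤ m → m ≡ n [mod q ] → q ∣ m ∸ n
≡-mod⇒∣∸ {q} {m} {n} n≤m = ≡.subst (q ∣_) ∣m-n∣≡m∸n
  where
  ∣m-n∣≡m∸n : ∣ + m - + n ∣ ≡ m ∸ n
  ∣m-n∣≡m∸n = ≡.trans (cong ∣_∣ (m-n≡m⊖n m n)) (≡.trans (∣m⊖n∣≡∣n⊖m∣ m n) (∣⊖∣-≤ n≤m))

module _ {c ℓ} (G : Group c ℓ) where
  open Group G
  open import Algebra.Properties.Group G using (∙-cancelˡ; inverseʳ-unique)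
  open import Algebra.Properties.Monoid.Mult monoid using (_×_; ×-homo-+; ×-congʳ; ×-assocˡ)
  open import Relation.Binary.Reasoning.Setoid setoid

  ×-ε : ∀ n → n × ε ≈ ε
  ×-ε zero    = refl
  ×-ε (suc n) = trans (identityˡ (n × ε)) (×-ε n)

  ∣⇒×≈ε : ∀ {g q n} → q × g ≈ ε → q ∣ n → n × g ≈ ε
  ∣⇒×≈ε {g} {q} q×g≈ε (divides t ≡.refl) = begin
    (t * q) × g  ≈⟨ ×-assocˡ g t q ⟨
    t × (q × g)  ≈⟨ ×-congʳ t q×g≈ε ⟩
    t × ε        ≈⟨ ×-ε t ⟩
    ε            ∎

  ×-commute : ∀ g m n → m × g ∙ n × g ≈ n × g ∙ m × g
  ×-commute g m n = begin
    m × g ∙ n × g  ≈⟨ ×-homo-+ g m n ⟨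
    (m + n) × g    ≡⟨ cong (_× g) (+-comm m n) ⟩
    (n + m) × g    ≈⟨ ×-homo-+ g n m ⟩
    n × g ∙ m × g  ∎

  ≤-≡-mod⇒×≈ : ∀ {g q m n} → q × g ≈ ε → n ≤ m → m ≡ n [mod q ] → m × g ≈ n × g
  ≤-≡-mod⇒×≈ {g} {q} {m} {n} q×g≈ε n≤m m≡n = begin
    m × g                ≡⟨ cong (_× g) (m∸n+n≡m n≤m) ⟨
    (m ∸ n + n) × g      ≈⟨ ×-homo-+ g (m ∸ n) n ⟩
    (m ∸ n) × g ∙ n × g  ≈⟨ ∙-congʳ (∣⇒×≈ε q×g≈ε (≡-mod⇒∣∸ n≤m m≡n)) ⟩
    ε ∙ n × g            ≈⟨ identityˡ (n × g) ⟩
    n × g                ∎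

  ≡-mod⇒×≈ : ∀ {g q m n} → q × g ≈ ε → m ≡ n [mod q ] → m × g ≈ n × g
  ≡-mod⇒×≈ {g} {q} {m} {n} q×g≈ε m≡n with ≤-total n m
  ... | inj₁ n≤m = ≤-≡-mod⇒×≈ q×g≈ε n≤m m≡n
  ... | inj₂ m≤n = sym (≤-≡-mod⇒×≈ q×g≈ε m≤n (≡-mod-sym {q} {m} {n} m≡n))

  ×-intertwine : ∀ x y n → x ∙ n × (y ∙ x) ≈ n × (x ∙ y) ∙ x
  ×-intertwine x y zero    = trans (identityʳ x) (sym (identityˡ x))
  ×-intertwine x y (suc n) = begin
    x ∙ (y ∙ x ∙ n × (y ∙ x))      ≈⟨ assoc x (y ∙ x) (n × (y ∙ x)) ⟨
    x ∙ (y ∙ x) ∙ n × (y ∙ x)      ≈⟨ ∙-congʳ (assoc x y x) ⟨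
    x ∙ y ∙ x ∙ n × (y ∙ x)        ≈⟨ assoc (x ∙ y) x (n × (y ∙ x)) ⟩
    x ∙ y ∙ (x ∙ n × (y ∙ x))      ≈⟨ ∙-congˡ (×-intertwine x y n) ⟩
    x ∙ y ∙ (n × (x ∙ y) ∙ x)      ≈⟨ assoc (x ∙ y) (n × (x ∙ y)) x ⟨
    x ∙ y ∙ n × (x ∙ y) ∙ x        ∎

  ×≈ε-swap : ∀ {x y q} → q × (x ∙ y) ≈ ε → q × (y ∙ x) ≈ ε
  ×≈ε-swap {x} {y} {q} q×xy≈ε = ∙-cancelˡ x (q × (y ∙ x)) ε (begin
    x ∙ q × (y ∙ x)  ≈⟨ ×-intertwine x y q ⟩
    q × (x ∙ y) ∙ x  ≈⟨ ∙-congʳ q×xy≈ε ⟩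
    ε ∙ x            ≈⟨ identityˡ x ⟩
    x                ≈⟨ identityʳ x ⟨
    x ∙ ε            ∎)

  Palindromic : Carrier → Carrier → Carrier → Carrier → Set ℓ
  Palindromic A B C D = A ∙ B ∙ C ∙ D ≈ D ∙ C ∙ B ∙ A

  palindromic-reverse : ∀ {A B C D} → Palindromic A B C D → Palindromic D C B A
  palindromic-reverse = sym

  palindromic-cong : ∀ {A B C D A′ B′ C′ D′} → A ≈ A′ → B ≈ B′ → C ≈ C′ → D ≈ D′ →
                     Palindromic A′ B′ C′ D′ → Palindromic A B C D
  palindromic-cong A≈A′ B≈B′ C≈C′ D≈D′ p = trans (∙-cong (∙-cong (∙-cong A≈A′ B≈B′) C≈C′) D≈D′)
    (trans p (sym (∙-cong (∙-cong (∙-cong D≈D′ C≈C′) B≈B′) A≈A′)))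

  palindromic-i : ∀ {A B C D} → A ≈ ε → C ≈ ε → B ∙ D ≈ D ∙ B → Palindromic A B C D
  palindromic-i {A} {B} {C} {D} A≈ε C≈ε BD≈DB = begin
    A ∙ B ∙ C ∙ D    ≈⟨ ∙-congʳ (∙-cong (∙-congʳ A≈ε) C≈ε) ⟩
    ε ∙ B ∙ ε ∙ D    ≈⟨ ∙-congʳ (trans (identityʳ (ε ∙ B)) (identityˡ B)) ⟩
    B ∙ D            ≈⟨ BD≈DB ⟩
    D ∙ B            ≈⟨ ∙-cong (identityʳ D) (identityʳ B) ⟨
    D ∙ ε ∙ (B ∙ ε)  ≈⟨ assoc (D ∙ ε) B ε ⟨
    D ∙ ε ∙ B ∙ ε    ≈⟨ ∙-cong (∙-congʳ (∙-congˡ C≈ε)) A≈ε ⟨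
    D ∙ C ∙ B ∙ A    ∎

  palindromic-ii : ∀ {A B C D} → B ≈ ε → A ∙ C ≈ ε → Palindromic A B C D
  palindromic-ii {A} {B} {C} {D} B≈ε AC≈ε = begin
    A ∙ B ∙ C ∙ D    ≈⟨ ∙-congʳ (∙-congʳ (∙-congˡ B≈ε)) ⟩
    A ∙ ε ∙ C ∙ D    ≈⟨ ∙-congʳ (∙-cong (identityʳ A) refl) ⟩
    A ∙ C ∙ D        ≈⟨ ∙-congʳ AC≈ε ⟩
    ε ∙ D            ≈⟨ identityˡ D ⟩
    D                ≈⟨ identityʳ D ⟨
    D ∙ ε            ≈⟨ ∙-congˡ CA≈ε ⟨
    D ∙ (C ∙ A)      ≈⟨ assoc D C A ⟨
    D ∙ C ∙ A        ≈⟨ ∙-congʳ (identityʳ (D ∙ C)) ⟨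
    D ∙ C ∙ ε ∙ A    ≈⟨ ∙-congʳ (∙-congˡ B≈ε) ⟨
    D ∙ C ∙ B ∙ A    ∎
    where
    CA≈ε : C ∙ A ≈ ε
    CA≈ε = trans (∙-congʳ (inverseʳ-unique A C AC≈ε)) (inverseˡ A)

  palindromic-iii : ∀ {A B C D} → A ≈ ε → B ≈ D → Palindromic A B C D
  palindromic-iii {A} {B} {C} {D} A≈ε B≈D = begin
    A ∙ B ∙ C ∙ D  ≈⟨ ∙-congʳ (∙-congʳ (∙-cong A≈ε B≈D)) ⟩
    ε ∙ D ∙ C ∙ D  ≈⟨ ∙-congʳ (∙-congʳ (identityˡ D)) ⟩
    D ∙ C ∙ D      ≈⟨ identityʳ (D ∙ C ∙ D) ⟨
    D ∙ C ∙ D ∙ ε  ≈⟨ ∙-cong (∙-congˡ B≈D) A≈ε ⟨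
    D ∙ C ∙ B ∙ A  ∎

  module _ {q u v} (q×u≈ε : q × u ≈ ε) (q×v≈ε : q × v ≈ ε) (a b c d : ℕ) where

    palindromic-×-i : q ∣ a → q ∣ c → Palindromic (a × u) (b × v) (c × u) (d × v)
    palindromic-×-i q∣a q∣c =
      palindromic-i (∣⇒×≈ε q×u≈ε q∣a) (∣⇒×≈ε q×u≈ε q∣c) (×-commute v b d)

    palindromic-×-ii : q ∣ a + c → q ∣ b → Palindromic (a × u) (b × v) (c × u) (d × v)
    palindromic-×-ii q∣a+c q∣b =
      palindromic-ii (∣⇒×≈ε q×v≈ε q∣b) (trans (sym (×-homo-+ u a c)) (∣⇒×≈ε q×u≈ε q∣a+c))

    palindromic-×-iii : q ∣ a → b ≡ d [mod q ] → Palindromic (a × u) (b × v) (c × u) (d × v)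
    palindromic-×-iii q∣a b≡d = palindromic-iii (∣⇒×≈ε q×u≈ε q∣a) (≡-mod⇒×≈ {m = b} {n = d} q×v≈ε b≡d)

  sixConditions⇒palindromic : ∀ {q u v} → q × u ≈ ε → q × v ≈ ε → ∀ {a b c d} →
    SixConditions q a b c d → Palindromic (a × u) (b × v) (c × u) (d × v)
  sixConditions⇒palindromic q×u≈ε q×v≈ε {a} {b} {c} {d} = λ where
    (inj₁ (q∣a , q∣c)) → palindromic-×-i q×u≈ε q×v≈ε a b c d q∣a q∣c
    (inj₂ (inj₁ (q∣a+c , q∣b))) → palindromic-×-ii q×u≈ε q×v≈ε a b c d q∣a+c q∣b
    (inj₂ (inj₂ (inj₁ (q∣a , b≡d)))) → palindromic-×-iii q×u≈ε q×v≈ε a b c d q∣a b≡d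
    (inj₂ (inj₂ (inj₂ (inj₁ (q∣d , q∣b))))) →
      palindromic-reverse (palindromic-×-i q×v≈ε q×u≈ε d c b a q∣d q∣b)
    (inj₂ (inj₂ (inj₂ (inj₂ (inj₁ (q∣d+b , q∣c)))))) →
      palindromic-reverse (palindromic-×-ii q×v≈ε q×u≈ε d c b a q∣d+b q∣c)
    (inj₂ (inj₂ (inj₂ (inj₂ (inj₂ (q∣d , c≡a)))))) →
      palindromic-reverse (palindromic-×-iii q×v≈ε q×u≈ε d c b a q∣d c≡a)

symmetricGroup : ℕ → Group 0ℓ 0ℓ
symmetricGroup k = record
  { Carrier = S k
  ; _≈_     = _≈ₚ_
  ; _∙_     = _·_
  ; ε       = id
  ; _⁻¹     = flip
  ; isGroup = record
    { isMonoid = record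
      { isSemigroup = record
        { isMagma = record
          { isEquivalence = record
            { refl  = λ _ → ≡.refl
            ; sym   = λ π≈ρ i → ≡.sym (π≈ρ i)
            ; trans = λ π≈ρ ρ≈σ i → ≡.trans (π≈ρ i) (ρ≈σ i)
            }
          ; ∙-cong = λ {π} {π′} {ρ} {ρ′} → ·-cong {π} {π′} {ρ} {ρ′}
          }
        ; assoc = λ _ _ _ _ → ≡.refl
        }
      ; identity = (λ _ _ → ≡.refl) , (λ _ _ → ≡.refl)
      }
    ; inverse = (λ π _ → Perm.inverseˡ π) , (λ π _ → Perm.inverseʳ π)
    ; ⁻¹-cong = λ {π} {ρ} → flip-cong {π} {ρ}
    }
  }
  where
  ·-cong : ∀ {π π′ ρ ρ′ : S k} → π ≈ₚ π′ → ρ ≈ₚ ρ′ → π · ρ ≈ₚ π′ · ρ′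
  ·-cong {π} {π′} {ρ} {ρ′} π≈π′ ρ≈ρ′ i = ≡.trans (cong (π ⟨$⟩ʳ_) (ρ≈ρ′ i)) (π≈π′ (ρ′ ⟨$⟩ʳ i))

  flip-cong : ∀ {π ρ : S k} → π ≈ₚ ρ → flip π ≈ₚ flip ρ
  flip-cong {π} {ρ} π≈ρ i = begin
    π ⟨$⟩ˡ i                    ≡⟨ cong (π ⟨$⟩ˡ_) (Perm.inverseʳ ρ) ⟨
    π ⟨$⟩ˡ (ρ ⟨$⟩ʳ (ρ ⟨$⟩ˡ i))  ≡⟨ cong (π ⟨$⟩ˡ_) (π≈ρ (ρ ⟨$⟩ˡ i)) ⟨
    π ⟨$⟩ˡ (π ⟨$⟩ʳ (ρ ⟨$⟩ˡ i))  ≡⟨ Perm.inverseˡ π ⟩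
    ρ ⟨$⟩ˡ i                    ∎
    where open ≡.≡-Reasoning

module _ {k : ℕ} where
  open import Algebra.Properties.Monoid.Mult (Group.monoid (symmetricGroup k)) using (_×_)

  ^≈ₚ× : ∀ (g : S k) n → g ^ n ≈ₚ n × g
  ^≈ₚ× g zero    i = ≡.refl
  ^≈ₚ× g (suc n) i = cong (g ⟨$⟩ʳ_) (^≈ₚ× g n i)

  period-sixConditions⇒palindromic : ∀ {q} (x y : S k) {a b c d} →
    (x · y) ^ q ≈ₚ id → SixConditions q a b c d →
    Palindromic (symmetricGroup k) ((x · y) ^ a) ((y · x) ^ b) ((x · y) ^ c) ((y · x) ^ d)
  period-sixConditions⇒palindromic {q} x y {a} {b} {c} {d} uᵠ≈id conditions =
    palindromic-cong Sₖ {u ^ a} {v ^ b} {u ^ c} {v ^ d} {a × u} {b × v} {c × u} {d × v}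
      (^≈ₚ× u a) (^≈ₚ× v b) (^≈ₚ× u c) (^≈ₚ× v d)
      (sixConditions⇒palindromic Sₖ {q} {u} {v} q×u≈ε (×≈ε-swap Sₖ {x} {y} {q} q×u≈ε) conditions)
    where
    Sₖ : Group 0ℓ 0ℓ
    Sₖ = symmetricGroup k

    u v : S k
    u = x · y
    v = y · x

    q×u≈ε : q × u ≈ₚ id
    q×u≈ε i = ≡.trans (≡.sym (^≈ₚ× u q i)) (uᵠ≈id i)

-- Imported only now: until here _×_ is the monoid power of Algebra.Properties.Monoid.Mult.
open import Data.Product using (_×_)

least-witness : ∀ {p} {P : Pred ℕ p} → Decidable P → ∀ {n} → P n →
                ∃ λ m → P m × (∀ j → j < m → ¬ P j)
least-witness {P = P} P? {n} = <-rec (λ n → P n → Least) search n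
  where
  Least : Set _
  Least = ∃ λ m → P m × (∀ j → j < m → ¬ P j)

  search : ∀ n → (∀ {m} → m < n → P m → Least) → P n → Least
  search n below Pn with anyUpTo? P? n
  ... | yes (m , m<n , Pm) = below m<n Pm
  ... | no ∄m<n            = n , Pn , λ j j<n Pj → ∄m<n (j , j<n , Pj)

module _ {k : ℕ} where

  ^-+-⟨$⟩ʳ : ∀ (g : S k) m n {i} → (g ^ (m + n)) ⟨$⟩ʳ i ≡ (g ^ m) ⟨$⟩ʳ ((g ^ n) ⟨$⟩ʳ i)
  ^-+-⟨$⟩ʳ g zero    n = ≡.refl
  ^-+-⟨$⟩ʳ g (suc m) n = cong (g ⟨$⟩ʳ_) (^-+-⟨$⟩ʳ g m n)

  ^-*-fixes : ∀ (g : S k) r t {i} → (g ^ r) ⟨$⟩ʳ i ≡ i → (g ^ (t * r)) ⟨$⟩ʳ i ≡ i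
  ^-*-fixes g r zero    fix = ≡.refl
  ^-*-fixes g r (suc t) fix =
    ≡.trans (^-+-⟨$⟩ʳ g r (t * r)) (≡.trans (cong ((g ^ r) ⟨$⟩ʳ_) (^-*-fixes g r t fix)) fix)

  ^-∣-fixes : ∀ (g : S k) {r n i} → r ∣ n → (g ^ r) ⟨$⟩ʳ i ≡ i → (g ^ n) ⟨$⟩ʳ i ≡ i
  ^-∣-fixes g {r} (divides t ≡.refl) = ^-*-fixes g r t

  orbit-returns : ∀ (g : S k) i → ∃ λ r → 1 ≤ r × r ≤ k × (g ^ r) ⟨$⟩ʳ i ≡ i
  -- Among g⁰ i, …, gᵏ i two agree, say gˢ i = gᵗ i with s < t; cancel gˢ.
  orbit-returns g i with pigeonhole (n<1+n k) (λ j → (g ^ toℕ j) ⟨$⟩ʳ i)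
  ... | s , t , s<t , gˢi≡gᵗi =
    toℕ t ∸ toℕ s , m<n⇒0<n∸m s<t , ≤-trans (m∸n≤m (toℕ t) (toℕ s)) (≤-pred (toℕ<n t)) ,
    Injection.injective (↔⇒↣ (g ^ toℕ s)) (begin
      (g ^ toℕ s) ⟨$⟩ʳ ((g ^ (toℕ t ∸ toℕ s)) ⟨$⟩ʳ i)  ≡⟨ ^-+-⟨$⟩ʳ g (toℕ s) (toℕ t ∸ toℕ s) ⟨
      (g ^ (toℕ s + (toℕ t ∸ toℕ s))) ⟨$⟩ʳ i            ≡⟨ cong (λ n → (g ^ n) ⟨$⟩ʳ i) (m+[n∸m]≡n (<⇒≤ s<t)) ⟩
      (g ^ toℕ t) ⟨$⟩ʳ i                                ≡⟨ gˢi≡gᵗi ⟨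
      (g ^ toℕ s) ⟨$⟩ʳ i                                ∎)
    where open ≡.≡-Reasoning

  ^-k!≈ₚid : ∀ (g : S k) → g ^ (k !) ≈ₚ id
  ^-k!≈ₚid g i with orbit-returns g i
  ... | r , 1≤r , r≤k , gʳi≡i = ^-∣-fixes g (∣n! 1≤r r≤k) gʳi≡i

  positivePeriod? : ∀ (g : S k) → Decidable (λ m → 1 ≤ m × g ^ m ≈ₚ id)
  positivePeriod? g m = (1 ≤? m) ×-dec all? (λ i → (g ^ m) ⟨$⟩ʳ i ≟ i)

  order-exists : ∀ (g : S k) → ∃ (IsOrderOf g)
  order-exists g with least-witness (positivePeriod? g) (1≤n! k , ^-k!≈ₚid g)
  ... | q , (1≤q , gᵠ≈id) , below = q , 1≤q , gᵠ≈id , λ m 1≤m m<q gᵐ≈id → below m m<q (1≤m , gᵐ≈id)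

proposition8 : (k : ℕ) → 1 ≤ k → (a b c d : ℕ)
    → (∀ q → ∃ (λ (g : S k) → IsOrderOf g q) → SixConditions q a b c d)
    → (x y : S k)
    → ((x · y) ^ a) · ((y · x) ^ b) · ((x · y) ^ c) · ((y · x) ^ d)
    ≈ₚ ((y · x) ^ d) · ((x · y) ^ c) · ((y · x) ^ b) · ((x · y) ^ a)
proposition8 k _ a b c d conditions x y with order-exists (x · y)
... | q , xy-has-order-q@(_ , xyᵠ≈id , _) =
  period-sixConditions⇒palindromic x y xyᵠ≈id (conditions q (x · y , xy-has-order-q))
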